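{- Let $\mathcal{F} \subseteq \mathcal{P}([n])$, $a \in [n]$ and $A \subseteq [n] \setminus \{a\}$. Then \[ \Lambda(\mathcal{F})_{(A, A \cup \{a\})} = \sum_{B \in A \oplus \rho(\{\emptyset\})} |B|!\,(n-1-|B|)! \; - \sum_{B \in A \oplus \rho(\{\{a\}\})} |B|!\,(n-1-|B|)!, \] where $\rho(\{\emptyset\}) = \{ C \subseteq [n]\setminus\{a\} : C \in \mathcal{F},\ C \cup \{a\} \notin \mathcal{F}\}$, $\rho(\{\{a\}\}) = \{ C \subseteq [n]\setminus\{a\} : C \notin \mathcal{F},\ C \cup \{a\} \in \mathcal{F}\}$, and $A \oplus \mathcal{C} = \{A \oplus C : C \in \mathcal{C}\}$.
   Context: $[n] = \{1,\dots,n\}$, $\mathcal{P}([n])$ is the power set, $\oplus$ is symmetric difference. (The factor $(n-1-|B|)!$ is $|B^c|!$ with the complement taken in $[n]\setminus\{a\}$; the sets $\rho(\cdot)$ are the preimages of $\{\emptyset\}$ and $\{\{a\}\}$ under the map $B \mapsto \{C \subseteq \{a\} : B \cup C \in \mathcal{F}\}$ on subsets $B$ of $[n]\setminus\{a\}$.) Let $\Sigma$ be the set of permutations of $[n]$. For $\sigma \in \Sigma$ and $X \subseteq [n]$ define the path $P^{\sigma,X}_0 = X$, $P^{\sigma,X}_k = P^{\sigma,X}_{k-1} \oplus \{\sigma(k)\}$ for $k \in [n]$. With $(e_{(Y,Z)})$ the standard basis of $\mathbb{R}^{\mathcal{P}([n])\times\mathcal{P}([n])}$, define \[ \Lambda(\mathcal{F})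 = \sum_{\sigma \in \Sigma} \sum_{X \in \mathcal{F}} \sum_{k \in [n]} \left( e_{(P^{\sigma,X}_{k-1}, P^{\sigma,X}_k)} - e_{(P^{\sigma,X}_k, P^{\sigma,X}_{k-1})} \right), \] so $\Lambda(\mathcal{F})_{(Y,Z)}$ counts steps from $Y$ to $Z$ minus steps from $Z$ to $Y$ over all these paths. -}

module Defs where

open import Data.Bool using (Bool; true; false; not; _∧_; _∨_; if_then_else_)
open import Data.Nat as ℕ using (ℕ; zero; suc; _∸_)
open import Data.Nat.Base using (_!)
open import Data.Fin as Fin using (Fin)
open import Data.Fin.Subset using (Subset; _─_; ⁅_⁆; ∣_∣) renaming (_∪_ to _∪ₛ_)
open import Data.Integer as ℤ using (ℤ; +_; _-_)
open import Data.List as List using (List; []; _∷_; concatMap; filterᵇ; map; allFin)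
open import Data.Bool.ListAction using (and; or)
open import Data.Vec as Vec using (Vec; []; _∷_; lookup; toList; zipWith)
import Data.Vec.Properties as VecP
import Data.Bool.Properties as BoolP
open import Data.Product using (_×_; _,_)
open import Relation.Nullary using (does)
open import Relation.Nullary.Decidable using (⌊_⌋)

-- Subsets of [n] are Subset n = Vec Bool n (Data.Fin.Subset); [n] is Fin n.

_=ₛ_ : ∀ {n} → Subset n → Subset n → Bool
X =ₛ Y = ⌊ VecP.≡-dec BoolP._≟_ X Y ⌋

_⊕_ : ∀ {n} → Subset n → Subset n → Subset n
_⊕_ = zipWith Data.Bool._xor_
  where import Data.Bool

toggle : ∀ {n} → Fin n → Subset n → Subset n
toggle i X = X ⊕ ⁅ i ⁆

allSubsets : (n : ℕ) → List (Subset n)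
allSubsets zero = [] ∷ []
allSubsets (suc n) = concatMap (λ X → (false ∷ X) ∷ (true ∷ X) ∷ []) (allSubsets n)

allVecs : (n m : ℕ) → List (Vec (Fin n) m)
allVecs n zero = [] ∷ []
allVecs n (suc m) = concatMap (λ v → map (λ i → i ∷ v) (allFin n)) (allVecs n m)

-- σ : [n] → [n], stored as the vector (σ(1), …, σ(n)), is injective
isInjective : ∀ {n} → Vec (Fin n) n → Bool
isInjective {n} σ =
  and (map (λ i → and (map (λ j →
    not ⌊ lookup σ i Fin.≟ lookup σ j ⌋ ∨ ⌊ i Fin.≟ j ⌋) (allFin n))) (allFin n))

permutations : (n : ℕ) → List (Vec (Fin n) n)
permutations n = filterᵇ (λ σ → isInjective σ) (allVecs n n)

-- the steps (P_{k-1}, P_k), k = 1..n, of the path starting at X that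
-- toggles successively the elements of the given list
steps : ∀ {n} → Subset n → List (Fin n) → List (Subset n × Subset n)
steps X [] = []
steps X (i ∷ is) = (X , toggle i X) ∷ steps (toggle i X) is

sumℤ : List ℤ → ℤ
sumℤ = List.foldr ℤ._+_ (+ 0)

indicator : Bool → ℤ
indicator true = + 1
indicator false = + 0

-- the contribution of one step (U , V) to the (Y , Z) entry:
-- e_(U,V) - e_(V,U) evaluated at (Y,Z)
stepValue : ∀ {n} → Subset n → Subset n → Subset n × Subset n → ℤ
stepValue Y Z (U , V) = indicator ((U =ₛ Y) ∧ (V =ₛ Z)) - indicator ((V =ₛ Y) ∧ (U =ₛ Z))

Family : ℕ → Set
Family n = Subset n → Bool

Λ : ∀ {n} → Family n → Subset n → Subset n → ℤ
Λ {n} 𝓕 Y Z =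
  sumℤ (map (λ σ →
    sumℤ (map (λ X →
      sumℤ (map (stepValue Y Z) (steps X (toList σ))))
      (filterᵇ (λ X → 𝓕 X) (allSubsets n))))
    (permutations n))

_∈ₛ_ : ∀ {n} → Fin n → Subset n → Bool
a ∈ₛ C = lookup C a

ρ∅ : ∀ {n} → Family n → Fin n → Subset n → Bool
ρ∅ 𝓕 a C = not (a ∈ₛ C) ∧ 𝓕 C ∧ not (𝓕 (C ∪ₛ ⁅ a ⁆))

ρa : ∀ {n} → Family n → Fin n → Subset n → Bool
ρa 𝓕 a C = not (a ∈ₛ C) ∧ not (𝓕 C) ∧ 𝓕 (C ∪ₛ ⁅ a ⁆)

inTranslate : ∀ {n} → Subset n → (Subset n → Bool) → Subset n → Bool
inTranslate {n} A 𝓒 B = or (map (λ C → 𝓒 C ∧ (B =ₛ (A ⊕ C))) (allSubsets n))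

weight : (n : ℕ) → ∀ {m} → Subset m → ℤ
weight n B = + ((∣ B ∣ !) ℕ.* ((n ∸ 1 ∸ ∣ B ∣) !))

weightedSum : ∀ {n} → Subset n → (Subset n → Bool) → ℤ
weightedSum {n} A 𝓒 =
  sumℤ (map (weight n)
    (filterᵇ (λ B → inTranslate A 𝓒 B) (allSubsets n)))

-- Along the path of a permutation σ from X, only the step that toggles a can traverse the edge
-- (A, A ∪ {a}), and it leaves from X ⊕ B, where B is the set of entries of σ preceding a; it
-- counts +1 when X ⊕ B = A and −1 when X ⊕ B = A ∪ {a}. Summing over X ∈ 𝓕 gives
-- [A ⊕ B ∈ 𝓕] − [(A ⊕ B) ∪ {a} ∈ 𝓕], and every B ⊆ [n] ∖ {a} is the prefix before a of exactly
-- |B|! (n − 1 − |B|)! permutations. Writing C = A ⊕ B, the difference of indicators is +1 exactly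
-- when C ∈ ρ({∅}) and −1 exactly when C ∈ ρ({{a}}).
module Submission where

open import Algebra.Structures using (IsMonoid)
open import Data.Bool using (Bool; true; false; not; _∧_; _∨_; _xor_; if_then_else_)
import Data.Bool.Properties as BoolP
open import Data.Bool.ListAction using (and; or)
open import Data.Fin as Fin using (Fin)
import Data.Fin.Properties as FinP
open import Data.Fin.Subset using (Subset; _∪_; ⁅_⁆; ⊥; ⊤; ∣_∣)
open import Data.Fin.Subset.Properties using (∣⊥∣≡0; ∣⊤∣≡n; ∣⁅x⁆∣≡1)
open import Data.Integer using (ℤ; +_; _+_; _-_; _*_)
import Data.Integer.Properties as ℤP
open import Data.Integer.Tactic.RingSolver using (solve-∀)
open import Data.List using (List; []; _∷_; _++_; map; concatMap; filterᵇ; foldr; allFin)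
import Data.List.Properties as ListP
open import Data.Nat as ℕ using (ℕ; zero; suc; _∸_; _!)
import Data.Nat.Properties as ℕP
open import Data.Product using (_,_)
open import Data.Vec using (Vec; []; _∷_; lookup; toList)
import Data.Vec.Properties as VecP
open import Function using (_∘_; _⇔_; mk⇔; Equivalence)
open import Function.Definitions using (Injective)
open import Relation.Binary.PropositionalEquality
open import Relation.Nullary using (Dec; yes; no; contradiction)
open import Relation.Nullary.Decidable using (⌊_⌋; isYes≗does; does-⇔)

open import Defs renaming (indicator to 𝟙)

open Equivalence using (to; from)
open ≡-Reasoning

private
  variable
    n m : ℕ

_==_ : Fin n → Fin n → Bool
i == j = ⌊ i Fin.≟ j ⌋

==-refl : (i : Fin n) → (i == i) ≡ true
==-refl i with i Fin.≟ i
... | yes _ = refl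
... | no i≢i = contradiction refl i≢i

==-≢ : {i j : Fin n} → i ≢ j → (i == j) ≡ false
==-≢ {i = i} {j} i≢j with i Fin.≟ j
... | yes i≡j = contradiction i≡j i≢j
... | no _ = refl

==⇒≡ : {i j : Fin n} → (i == j) ≡ true → i ≡ j
==⇒≡ {i = i} {j} eq with i Fin.≟ j
... | yes i≡j = i≡j
==⇒≡ () | no _

⌊⌋-⇔ : {P Q : Set} → P ⇔ Q → (p : Dec P) (q : Dec Q) → ⌊ p ⌋ ≡ ⌊ q ⌋
⌊⌋-⇔ P⇔Q p q = trans (isYes≗does p) (trans (does-⇔ P⇔Q p q) (sym (isYes≗does q)))

=ₛ-⇔ : {X Y : Subset n} {X′ Y′ : Subset m} → (X ≡ Y ⇔ X′ ≡ Y′) → (X =ₛ Y) ≡ (X′ =ₛ Y′)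
=ₛ-⇔ {X = X} {Y} {X′} {Y′} e =
  ⌊⌋-⇔ e (VecP.≡-dec BoolP._≟_ X Y) (VecP.≡-dec BoolP._≟_ X′ Y′)

=ₛ⇒≡ : {X Y : Subset n} → (X =ₛ Y) ≡ true → X ≡ Y
=ₛ⇒≡ {X = X} {Y} eq with VecP.≡-dec BoolP._≟_ X Y
... | yes X≡Y = X≡Y
=ₛ⇒≡ () | no _

=ₛ-refl : (X : Subset n) → (X =ₛ X) ≡ true
=ₛ-refl X with VecP.≡-dec BoolP._≟_ X X
... | yes _ = refl
... | no X≢X = contradiction refl X≢X

=ₛ-≢ : {X Y : Subset n} → X ≢ Y → (X =ₛ Y) ≡ false
=ₛ-≢ {X = X} {Y} X≢Y with VecP.≡-dec BoolP._≟_ X Y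
... | yes X≡Y = contradiction X≡Y X≢Y
... | no _ = refl

=ₛ-sym : (X Y : Subset n) → (X =ₛ Y) ≡ (Y =ₛ X)
=ₛ-sym X Y = =ₛ-⇔ (mk⇔ sym sym)

∷-=ₛ-∷ : ∀ b (X Y : Subset n) → ((b ∷ X) =ₛ (b ∷ Y)) ≡ (X =ₛ Y)
∷-=ₛ-∷ b X Y = =ₛ-⇔ (mk⇔ VecP.∷-injectiveʳ (cong (b ∷_)))

∷-=ₛ-not∷ : ∀ b (X Y : Subset n) → ((not b ∷ X) =ₛ (b ∷ Y)) ≡ false
∷-=ₛ-not∷ b X Y = =ₛ-≢ (BoolP.not-¬ refl ∘ sym ∘ VecP.∷-injectiveˡ)

∧-=ₛ-subst : (P : Subset n → Bool) (X Y : Subset n) → (X =ₛ Y) ∧ P X ≡ (X =ₛ Y) ∧ P Y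
∧-=ₛ-subst P X Y with X =ₛ Y in eq
... | true = cong P (=ₛ⇒≡ eq)
... | false = refl

-- Symmetric difference and toggling

⊕-assoc : (X Y Z : Subset n) → (X ⊕ Y) ⊕ Z ≡ X ⊕ (Y ⊕ Z)
⊕-assoc = VecP.zipWith-assoc BoolP.xor-assoc

⊕-comm : (X Y : Subset n) → X ⊕ Y ≡ Y ⊕ X
⊕-comm = VecP.zipWith-comm BoolP.xor-comm

⊕-identityʳ : (X : Subset n) → X ⊕ ⊥ ≡ X
⊕-identityʳ = VecP.zipWith-identityʳ BoolP.xor-identityʳ

⊕-self : (X : Subset n) → X ⊕ X ≡ ⊥
⊕-self X = trans (cong (X ⊕_) (sym (VecP.map-id X))) (VecP.zipWith-inverseʳ BoolP.xor-same X)

⊕-cancelʳ : (X Y : Subset n) → (X ⊕ Y) ⊕ Y ≡ X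
⊕-cancelʳ X Y = trans (⊕-assoc X Y Y) (trans (cong (X ⊕_) (⊕-self Y)) (⊕-identityʳ X))

⊕-cancelˡ : (X Y : Subset n) → X ⊕ (X ⊕ Y) ≡ Y
⊕-cancelˡ X Y = trans (⊕-comm X (X ⊕ Y)) (trans (cong (_⊕ X) (⊕-comm X Y)) (⊕-cancelʳ Y X))

toggle-⊕ : (i : Fin n) (X Y : Subset n) → toggle i X ⊕ Y ≡ X ⊕ toggle i Y
toggle-⊕ i X Y = trans (⊕-assoc X ⁅ i ⁆ Y) (cong (X ⊕_) (⊕-comm ⁅ i ⁆ Y))

=ₛ-⊕ : (X W Y : Subset n) → ((X ⊕ W) =ₛ Y) ≡ (X =ₛ (Y ⊕ W))
=ₛ-⊕ X W Y = =ₛ-⇔ (mk⇔ (λ e → trans (sym (⊕-cancelʳ X W)) (cong (_⊕ W) e))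
                        (λ e → trans (cong (_⊕ W) e) (⊕-cancelʳ Y W)))

lookup-⊥ : (j : Fin n) → lookup ⊥ j ≡ false
lookup-⊥ j = VecP.lookup-replicate j false

lookup-⊤ : (j : Fin n) → lookup ⊤ j ≡ true
lookup-⊤ j = VecP.lookup-replicate j true

lookup-⁅⁆ : (i j : Fin n) → lookup ⁅ i ⁆ j ≡ (j == i)
lookup-⁅⁆ Fin.zero Fin.zero = refl
lookup-⁅⁆ Fin.zero (Fin.suc j) = lookup-⊥ j
lookup-⁅⁆ (Fin.suc i) Fin.zero = refl
lookup-⁅⁆ (Fin.suc i) (Fin.suc j) with j Fin.≟ i | lookup-⁅⁆ i j
... | yes _ | eq = eq
... | no _ | eq = eq

lookup-toggle : (i j : Fin n) (X : Subset n) → lookup (toggle i X) j ≡ lookup X j xor (j == i)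
lookup-toggle i j X = trans (VecP.lookup-zipWith _ j X ⁅ i ⁆) (cong (lookup X j xor_) (lookup-⁅⁆ i j))

lookup-toggle-≡ : (i : Fin n) (X : Subset n) → lookup (toggle i X) i ≡ not (lookup X i)
lookup-toggle-≡ i X = trans (lookup-toggle i i X) (trans (cong (lookup X i xor_) (==-refl i)) (BoolP.xor-comm _ true))

lookup-toggle-≢ : {i j : Fin n} (X : Subset n) → j ≢ i → lookup (toggle i X) j ≡ lookup X j
lookup-toggle-≢ {i = i} {j} X j≢i =
  trans (lookup-toggle i j X) (trans (cong (lookup X j xor_) (==-≢ j≢i)) (BoolP.xor-identityʳ _))

toggle-=ₛ-toggle : (i j : Fin n) (X : Subset n) → (toggle i X =ₛ toggle j X) ≡ (i == j)
toggle-=ₛ-toggle i j X = ⌊⌋-⇔ (mk⇔ injective (cong (λ k → toggle k X))) _ (i Fin.≟ j)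
  where
  injective : toggle i X ≡ toggle j X → i ≡ j
  injective eq = ==⇒≡ (begin
    (i == j)                        ≡⟨ lookup-⁅⁆ j i ⟨
    lookup ⁅ j ⁆ i                  ≡⟨ cong (λ Y → lookup Y i) (⊕-cancelˡ X ⁅ j ⁆) ⟨
    lookup (X ⊕ toggle j X) i       ≡⟨ cong (λ Y → lookup (X ⊕ Y) i) eq ⟨
    lookup (X ⊕ toggle i X) i       ≡⟨ cong (λ Y → lookup Y i) (⊕-cancelˡ X ⁅ i ⁆) ⟩
    lookup ⁅ i ⁆ i                  ≡⟨ lookup-⁅⁆ i i ⟩
    (i == i)                        ≡⟨ ==-refl i ⟩
    true                            ∎)

toggle-⊆ : {i j : Fin n} {X : Subset n} → lookup X i ≡ true → lookup (toggle i X) j ≡ true → lookup X j ≡ true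
toggle-⊆ {i = i} {j} {X} X∋i toggled∋j with j Fin.≟ i
... | yes refl = contradiction (trans (sym toggled∋j) (trans (lookup-toggle-≡ i X) (cong not X∋i))) λ ()
... | no j≢i = trans (sym (lookup-toggle-≢ X j≢i)) toggled∋j

toggle-⊆-toggle : {i : Fin n} {X Y : Subset n} → lookup X i ≡ true →
  (∀ {j} → lookup X j ≡ true → lookup Y j ≡ true) →
  ∀ {j} → lookup (toggle i X) j ≡ true → lookup (toggle i Y) j ≡ true
toggle-⊆-toggle {i = i} {X} {Y} X∋i X⊆Y {j} ∋j with j Fin.≟ i
... | yes refl = contradiction (trans (sym ∋j) (trans (lookup-toggle-≡ i X) (cong not X∋i))) λ ()
... | no j≢i = trans (lookup-toggle-≢ Y j≢i) (X⊆Y (trans (sym (lookup-toggle-≢ X j≢i)) ∋j))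

∪-⁅⁆ : {X : Subset n} {a : Fin n} → lookup X a ≡ false → X ∪ ⁅ a ⁆ ≡ toggle a X
∪-⁅⁆ {X = false ∷ X} {Fin.zero} _ = cong (true ∷_) (trans (∪-⊥ X) (sym (⊕-identityʳ X)))
  where
  ∪-⊥ : (Y : Subset m) → Y ∪ ⊥ ≡ Y
  ∪-⊥ = VecP.zipWith-identityʳ BoolP.∨-identityʳ
∪-⁅⁆ {X = x ∷ X} {Fin.suc a} X∌a =
  cong₂ _∷_ (trans (BoolP.∨-identityʳ x) (sym (BoolP.xor-identityʳ x))) (∪-⁅⁆ X∌a)

∣∣≡suc∣toggle∣ : {i : Fin n} (X : Subset n) → lookup X i ≡ true → ∣ X ∣ ≡ suc ∣ toggle i X ∣
∣∣≡suc∣toggle∣ {i = Fin.zero} (true ∷ X) _ = cong suc (cong ∣_∣ (sym (⊕-identityʳ X)))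
∣∣≡suc∣toggle∣ {i = Fin.suc i} (true ∷ X) X∋i = cong suc (∣∣≡suc∣toggle∣ X X∋i)
∣∣≡suc∣toggle∣ {i = Fin.suc i} (false ∷ X) X∋i = ∣∣≡suc∣toggle∣ X X∋i

∣toggle∣≡ : {i : Fin n} {X : Subset n} → lookup X i ≡ true → ∣ X ∣ ≡ suc m → ∣ toggle i X ∣ ≡ m
∣toggle∣≡ {X = X} X∋i ∣X∣≡1+m = ℕP.suc-injective (trans (sym (∣∣≡suc∣toggle∣ X X∋i)) ∣X∣≡1+m)

∣∣≡0⇒≡⊥ : (X : Subset n) → ∣ X ∣ ≡ 0 → X ≡ ⊥
∣∣≡0⇒≡⊥ [] _ = refl
∣∣≡0⇒≡⊥ (false ∷ X) ∣X∣≡0 = cong (false ∷_) (∣∣≡0⇒≡⊥ X ∣X∣≡0)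

-- Sums over lists

module _ {M : Set} {_∙_ : M → M → M} {ε : M} (isMonoid : IsMonoid _≡_ _∙_ ε) where
  open IsMonoid isMonoid using (assoc; identityˡ; identityʳ)

  foldMap : {A : Set} → (A → M) → List A → M
  foldMap f xs = foldr _∙_ ε (map f xs)

  foldMap-++ : {A : Set} (f : A → M) (xs ys : List A) →
    foldMap f (xs ++ ys) ≡ foldMap f xs ∙ foldMap f ys
  foldMap-++ f [] ys = sym (identityˡ _)
  foldMap-++ f (x ∷ xs) ys = trans (cong (f x ∙_) (foldMap-++ f xs ys)) (sym (assoc _ _ _))

  foldMap-concatMap : {A B : Set} (f : B → M) (g : A → List B) (xs : List A) →
    foldMap f (concatMap g xs) ≡ foldMap (foldMap f ∘ g) xs
  foldMap-concatMap f g [] = refl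
  foldMap-concatMap f g (x ∷ xs) = trans (foldMap-++ f (g x) _) (cong (_ ∙_) (foldMap-concatMap f g xs))

  foldMap-select : ∀ n (C : Subset n) (h : Subset n → M) →
    foldMap (λ B → if B =ₛ C then h B else ε) (allSubsets n) ≡ h C
  foldMap-select zero [] h = identityʳ (h [])
  foldMap-select (suc n) (c ∷ C) h = begin
    foldMap (select c) (concatMap extensions (allSubsets n))
      ≡⟨ foldMap-concatMap (select c) extensions (allSubsets n) ⟩
    foldMap (foldMap (select c) ∘ extensions) (allSubsets n)
      ≡⟨ cong (foldr _∙_ ε) (ListP.map-cong (pair c) (allSubsets n)) ⟩
    foldMap (λ X → if X =ₛ C then h (c ∷ X) else ε) (allSubsets n)
      ≡⟨ foldMap-select n C (h ∘ (c ∷_)) ⟩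
    h (c ∷ C) ∎
    where
    select : Bool → Subset (suc n) → M
    select c B = if B =ₛ (c ∷ C) then h B else ε
    extensions : Subset n → List (Subset (suc n))
    extensions X = (false ∷ X) ∷ (true ∷ X) ∷ []
    pair : ∀ c (X : Subset n) →
      select c (false ∷ X) ∙ (select c (true ∷ X) ∙ ε) ≡ (if X =ₛ C then h (c ∷ X) else ε)
    pair false X rewrite ∷-=ₛ-∷ false X C | ∷-=ₛ-not∷ false X C =
      trans (cong (_ ∙_) (identityʳ ε)) (identityʳ _)
    pair true X rewrite ∷-=ₛ-∷ true X C | ∷-=ₛ-not∷ true X C = trans (identityˡ _) (identityʳ _)

∑ : {A : Set} → List A → (A → ℤ) → ℤ
∑ xs f = sumℤ (map f xs)

module _ {A : Set} where

  ∑-cong : (xs : List A) {f g : A → ℤ} → (∀ x → f x ≡ g x) → ∑ xs f ≡ ∑ xs g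
  ∑-cong xs f≗g = cong sumℤ (ListP.map-cong f≗g xs)

  ∑-zero : (xs : List A) {f : A → ℤ} → (∀ x → f x ≡ + 0) → ∑ xs f ≡ + 0
  ∑-zero [] f≗0 = refl
  ∑-zero (x ∷ xs) f≗0 = cong₂ _+_ (f≗0 x) (∑-zero xs f≗0)

  ∑-distrib-+ : (xs : List A) (f g : A → ℤ) → ∑ xs (λ x → f x + g x) ≡ ∑ xs f + ∑ xs g
  ∑-distrib-+ [] f g = refl
  ∑-distrib-+ (x ∷ xs) f g = trans (cong (_+_ (f x + g x)) (∑-distrib-+ xs f g)) (medial (f x) (g x) (∑ xs f) (∑ xs g))
    where
    medial : ∀ a b c d → (a + b) + (c + d) ≡ (a + c) + (b + d)
    medial = solve-∀

  ∑-distrib-- : (xs : List A) (f g : A → ℤ) → ∑ xs (λ x → f x - g x) ≡ ∑ xs f - ∑ xs g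
  ∑-distrib-- [] f g = refl
  ∑-distrib-- (x ∷ xs) f g = trans (cong (_+_ (f x - g x)) (∑-distrib-- xs f g)) (medial (f x) (g x) (∑ xs f) (∑ xs g))
    where
    medial : ∀ a b c d → (a - b) + (c - d) ≡ (a + c) - (b + d)
    medial = solve-∀

  ∑-*ʳ : (xs : List A) (f : A → ℤ) (c : ℤ) → ∑ xs (λ x → f x * c) ≡ ∑ xs f * c
  ∑-*ʳ [] f c = refl
  ∑-*ʳ (x ∷ xs) f c = trans (cong (_+_ (f x * c)) (∑-*ʳ xs f c)) (sym (ℤP.*-distribʳ-+ c (f x) _))

  ∑-filterᵇ : (p : A → Bool) (xs : List A) (f : A → ℤ) → ∑ (filterᵇ p xs) f ≡ ∑ xs (λ x → 𝟙 (p x) * f x)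
  ∑-filterᵇ p [] f = refl
  ∑-filterᵇ p (x ∷ xs) f with p x
  ... | true = cong₂ _+_ (sym (ℤP.*-identityˡ (f x))) (∑-filterᵇ p xs f)
  ... | false = trans (∑-filterᵇ p xs f) (sym (ℤP.+-identityˡ _))


∑-comm : {A B : Set} (xs : List A) (ys : List B) (f : A → B → ℤ) →
  ∑ xs (λ x → ∑ ys (f x)) ≡ ∑ ys (λ y → ∑ xs (λ x → f x y))
∑-comm [] ys f = sym (∑-zero ys (λ _ → refl))
∑-comm (x ∷ xs) ys f =
  trans (cong (_+_ (∑ ys (f x))) (∑-comm xs ys f)) (sym (∑-distrib-+ ys (f x) _))

𝟙-∧ : ∀ x y → 𝟙 (x ∧ y) ≡ 𝟙 x * 𝟙 y
𝟙-∧ true true = refl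
𝟙-∧ true false = refl
𝟙-∧ false y = refl

𝟙-if : ∀ b (x : ℤ) → (if b then x else + 0) ≡ 𝟙 b * x
𝟙-if true x = sym (ℤP.*-identityˡ x)
𝟙-if false x = refl

𝟙-*-cong : ∀ b {x y : ℤ} → (b ≡ true → x ≡ y) → 𝟙 b * x ≡ 𝟙 b * y
𝟙-*-cong true x≡y = cong (+ 1 *_) (x≡y refl)
𝟙-*-cong false x≡y = refl

∑-select : ∀ n (C : Subset n) (h : Subset n → ℤ) → ∑ (allSubsets n) (λ B → 𝟙 (B =ₛ C) * h B) ≡ h C
∑-select n C h =
  trans (∑-cong (allSubsets n) (λ B → sym (𝟙-if (B =ₛ C) (h B)))) (foldMap-select ℤP.+-0-isMonoid n C h)

∑-allVecs-suc : ∀ n m (f : Vec (Fin n) (suc m) → ℤ) →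
  ∑ (allVecs n (suc m)) f ≡ ∑ (allFin n) (λ i → ∑ (allVecs n m) (λ v → f (i ∷ v)))
∑-allVecs-suc n m f = begin
  ∑ (allVecs n (suc m)) f
    ≡⟨ foldMap-concatMap ℤP.+-0-isMonoid f (λ v → map (_∷ v) (allFin n)) (allVecs n m) ⟩
  ∑ (allVecs n m) (λ v → ∑ (map (_∷ v) (allFin n)) f)
    ≡⟨ ∑-cong (allVecs n m) (λ v → cong sumℤ (ListP.map-∘ (allFin n))) ⟨
  ∑ (allVecs n m) (λ v → ∑ (allFin n) (λ i → f (i ∷ v)))
    ≡⟨ ∑-comm (allVecs n m) (allFin n) (λ v i → f (i ∷ v)) ⟩
  ∑ (allFin n) (λ i → ∑ (allVecs n m) (λ v → f (i ∷ v))) ∎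

map-allFin-suc : {A : Set} (f : Fin (suc n) → A) →
  map f (allFin (suc n)) ≡ f Fin.zero ∷ map (f ∘ Fin.suc) (allFin n)
map-allFin-suc f = cong (f Fin.zero ∷_)
  (trans (ListP.map-tabulate Fin.suc f) (sym (ListP.map-tabulate (λ i → i) (f ∘ Fin.suc))))

∑-𝟙-lookup : (X : Subset n) (c : ℤ) → ∑ (allFin n) (λ i → 𝟙 (lookup X i) * c) ≡ + ∣ X ∣ * c
∑-𝟙-lookup [] c = refl
∑-𝟙-lookup (x ∷ X) c = begin
  ∑ (allFin _) (λ i → 𝟙 (lookup (x ∷ X) i) * c)
    ≡⟨ cong sumℤ (map-allFin-suc (λ i → 𝟙 (lookup (x ∷ X) i) * c)) ⟩
  𝟙 x * c + ∑ (allFin _) (λ i → 𝟙 (lookup X i) * c)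
    ≡⟨ cong (_+_ (𝟙 x * c)) (∑-𝟙-lookup X c) ⟩
  𝟙 x * c + + ∣ X ∣ * c
    ≡⟨ ℤP.*-distribʳ-+ c (𝟙 x) (+ ∣ X ∣) ⟨
  (𝟙 x + + ∣ X ∣) * c
    ≡⟨ cong (_* c) (count x) ⟩
  + ∣ x ∷ X ∣ * c ∎
  where
  count : ∀ x → 𝟙 x + + ∣ X ∣ ≡ + ∣ x ∷ X ∣
  count true = refl
  count false = ℤP.+-identityˡ _

∑-𝟙-== : (a : Fin n) (c : ℤ) → ∑ (allFin n) (λ i → 𝟙 (i == a) * c) ≡ c
∑-𝟙-== a c = begin
  ∑ (allFin _) (λ i → 𝟙 (i == a) * c)          ≡⟨ ∑-cong (allFin _) (λ i → cong (λ b → 𝟙 b * c) (lookup-⁅⁆ a i)) ⟨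
  ∑ (allFin _) (λ i → 𝟙 (lookup ⁅ a ⁆ i) * c)  ≡⟨ ∑-𝟙-lookup ⁅ a ⁆ c ⟩
  + ∣ ⁅ a ⁆ ∣ * c                             ≡⟨ cong (λ k → + k * c) (∣⁅x⁆∣≡1 a) ⟩
  + 1 * c                                     ≡⟨ ℤP.*-identityˡ c ⟩
  c ∎

∑-fibres : {C : Set} (xs : List C) (p : C → Bool) (g : C → Subset n) (h : Subset n → ℤ) →
  ∑ xs (λ x → 𝟙 (p x) * h (g x)) ≡ ∑ (allSubsets n) (λ B → ∑ xs (λ x → 𝟙 (p x ∧ (g x =ₛ B))) * h B)
∑-fibres {n} xs p g h = begin
  ∑ xs (λ x → 𝟙 (p x) * h (g x))
    ≡⟨ ∑-cong xs (λ x → ∑-select n (g x) (λ B → 𝟙 (p x) * h B)) ⟨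
  ∑ xs (λ x → ∑ (allSubsets n) (λ B → 𝟙 (B =ₛ g x) * (𝟙 (p x) * h B)))
    ≡⟨ ∑-comm xs (allSubsets n) _ ⟩
  ∑ (allSubsets n) (λ B → ∑ xs (λ x → 𝟙 (B =ₛ g x) * (𝟙 (p x) * h B)))
    ≡⟨ ∑-cong (allSubsets n) (λ B → trans (∑-cong xs (λ x → term x B)) (∑-*ʳ xs _ (h B))) ⟩
  ∑ (allSubsets n) (λ B → ∑ xs (λ x → 𝟙 (p x ∧ (g x =ₛ B))) * h B) ∎
  where
  rearrange : ∀ a b c → a * (b * c) ≡ b * a * c
  rearrange = solve-∀
  term : ∀ x B → 𝟙 (B =ₛ g x) * (𝟙 (p x) * h B) ≡ 𝟙 (p x ∧ (g x =ₛ B)) * h B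
  term x B = begin
    𝟙 (B =ₛ g x) * (𝟙 (p x) * h B)  ≡⟨ rearrange (𝟙 (B =ₛ g x)) (𝟙 (p x)) (h B) ⟩
    𝟙 (p x) * 𝟙 (B =ₛ g x) * h B    ≡⟨ cong (λ b → 𝟙 (p x) * 𝟙 b * h B) (=ₛ-sym B (g x)) ⟩
    𝟙 (p x) * 𝟙 (g x =ₛ B) * h B    ≡⟨ cong (_* h B) (𝟙-∧ (p x) (g x =ₛ B)) ⟨
    𝟙 (p x ∧ (g x =ₛ B)) * h B      ∎

∧-if : ∀ x b → x ∧ b ≡ (if b then x else false)
∧-if x true = BoolP.∧-identityʳ x
∧-if x false = BoolP.∧-zeroʳ x

inTranslate-⊕ : (A : Subset n) (𝒞 : Subset n → Bool) (B : Subset n) → inTranslate A 𝒞 B ≡ 𝒞 (B ⊕ A)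
inTranslate-⊕ {n} A 𝒞 B =
  trans (cong or (ListP.map-cong term (allSubsets n))) (foldMap-select BoolP.∨-isMonoid n (B ⊕ A) 𝒞)
  where
  term : ∀ C → 𝒞 C ∧ (B =ₛ (A ⊕ C)) ≡ (if C =ₛ (B ⊕ A) then 𝒞 C else false)
  term C = trans (cong (𝒞 C ∧_) (begin
    (B =ₛ (A ⊕ C))  ≡⟨ =ₛ-sym B (A ⊕ C) ⟩
    ((A ⊕ C) =ₛ B)  ≡⟨ cong (_=ₛ B) (⊕-comm A C) ⟩
    ((C ⊕ A) =ₛ B)  ≡⟨ =ₛ-⊕ C A B ⟩
    (C =ₛ (B ⊕ A))  ∎)) (∧-if (𝒞 C) _)

weightedSum-∑ : (A : Subset n) (𝒞 : Subset n → Bool) →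
  weightedSum A 𝒞 ≡ ∑ (allSubsets n) (λ B → 𝟙 (𝒞 (B ⊕ A)) * weight n B)
weightedSum-∑ {n} A 𝒞 = trans (∑-filterᵇ (inTranslate A 𝒞) (allSubsets n) (weight n))
  (∑-cong (allSubsets n) (λ B → cong (λ b → 𝟙 b * weight n B) (inTranslate-⊕ A 𝒞 B)))

-- Arrangements of a set and their prefixes

and-allFin⇔ : (f : Fin n → Bool) → and (map f (allFin n)) ≡ true ⇔ (∀ i → f i ≡ true)
and-allFin⇔ {zero} f = mk⇔ (λ _ ()) (λ _ → refl)
and-allFin⇔ {suc n} f = mk⇔
  (λ { h Fin.zero → BoolP.∧-conicalˡ _ _ (trans (sym unfold) h)
     ; h (Fin.suc i) → to (and-allFin⇔ (f ∘ Fin.suc)) (BoolP.∧-conicalʳ _ _ (trans (sym unfold) h)) i })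
  (λ h → trans unfold (cong₂ _∧_ (h Fin.zero) (from (and-allFin⇔ (f ∘ Fin.suc)) (h ∘ Fin.suc))))
  where
  unfold : and (map f (allFin (suc n))) ≡ f Fin.zero ∧ and (map (f ∘ Fin.suc) (allFin n))
  unfold = cong and (map-allFin-suc f)

implication⇔ : {P Q : Set} (p : Dec P) (q : Dec Q) → (not ⌊ p ⌋ ∨ ⌊ q ⌋) ≡ true ⇔ (P → Q)
implication⇔ (yes p) (yes q) = mk⇔ (λ _ _ → q) (λ _ → refl)
implication⇔ (yes p) (no ¬q) = mk⇔ (λ ()) (λ p⇒q → contradiction (p⇒q p) ¬q)
implication⇔ (no ¬p) q = mk⇔ (λ _ p → contradiction p ¬p) (λ _ → refl)

isInjective⇔ : (σ : Vec (Fin n) n) → isInjective σ ≡ true ⇔ Injective _≡_ _≡_ (lookup σ)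
isInjective⇔ σ = mk⇔
  (λ h {i} {j} → to (implication⇔ (lookup σ i Fin.≟ lookup σ j) (i Fin.≟ j))
                    (to (and-allFin⇔ _) (to (and-allFin⇔ _) h i) j))
  (λ inj → from (and-allFin⇔ _) (λ i → from (and-allFin⇔ _) (λ j →
     from (implication⇔ (lookup σ i Fin.≟ lookup σ j) (i Fin.≟ j)) inj)))

arranges : Subset n → Vec (Fin n) m → Bool
arranges U [] = true
arranges U (i ∷ v) = lookup U i ∧ arranges (toggle i U) v

arranges⇒⊆ : {U : Subset n} (v : Vec (Fin n) m) → arranges U v ≡ true → ∀ k → lookup U (lookup v k) ≡ true
arranges⇒⊆ (i ∷ v) arr Fin.zero = BoolP.∧-conicalˡ _ _ arr
arranges⇒⊆ {U = U} (i ∷ v) arr (Fin.suc k) =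
  toggle-⊆ {X = U} (BoolP.∧-conicalˡ _ _ arr) (arranges⇒⊆ v (BoolP.∧-conicalʳ _ _ arr) k)

head∉tail : {U : Subset n} (i : Fin n) (v : Vec (Fin n) m) → arranges U (i ∷ v) ≡ true → ∀ k → lookup v k ≢ i
head∉tail {U = U} i v arr k vₖ≡i = contradiction
  (trans (sym (subst (λ j → lookup (toggle i U) j ≡ true) vₖ≡i (arranges⇒⊆ v (BoolP.∧-conicalʳ _ _ arr) k)))
         (trans (lookup-toggle-≡ i U) (cong not (BoolP.∧-conicalˡ _ _ arr))))
  λ ()

arranges⇒injective : {U : Subset n} (v : Vec (Fin n) m) → arranges U v ≡ true → Injective _≡_ _≡_ (lookup v)
arranges⇒injective (i ∷ v) arr {Fin.zero} {Fin.zero} _ = refl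
arranges⇒injective (i ∷ v) arr {Fin.zero} {Fin.suc k} i≡vₖ = contradiction (sym i≡vₖ) (head∉tail i v arr k)
arranges⇒injective (i ∷ v) arr {Fin.suc k} {Fin.zero} vₖ≡i = contradiction vₖ≡i (head∉tail i v arr k)
arranges⇒injective (i ∷ v) arr {Fin.suc k} {Fin.suc l} vₖ≡vₗ =
  cong Fin.suc (arranges⇒injective v (BoolP.∧-conicalʳ _ _ arr) vₖ≡vₗ)

injective⇒arranges : {U : Subset n} (v : Vec (Fin n) m) →
  (∀ k → lookup U (lookup v k) ≡ true) → Injective _≡_ _≡_ (lookup v) → arranges U v ≡ true
injective⇒arranges [] _ _ = refl
injective⇒arranges {U = U} (i ∷ v) v⊆U inj =
  cong₂ _∧_ (v⊆U Fin.zero) (injective⇒arranges v tail⊆ (FinP.suc-injective ∘ inj))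
  where
  tail⊆ : ∀ k → lookup (toggle i U) (lookup v k) ≡ true
  tail⊆ k = trans (lookup-toggle-≢ U (λ vₖ≡i → contradiction (inj {Fin.suc k} {Fin.zero} vₖ≡i) λ ())) (v⊆U (Fin.suc k))

isInjective≡arranges⊤ : (σ : Vec (Fin n) n) → isInjective σ ≡ arranges ⊤ σ
isInjective≡arranges⊤ σ = BoolP.⇔→≡ (mk⇔
  (injective⇒arranges σ (λ k → lookup-⊤ (lookup σ k)) ∘ to (isInjective⇔ σ))
  (from (isInjective⇔ σ) ∘ arranges⇒injective σ))

arrangements : ∀ m (U : Subset n) → ∣ U ∣ ≡ m → ∑ (allVecs n m) (𝟙 ∘ arranges U) ≡ + (m !)
arrangements zero U _ = refl
arrangements {n} (suc m) U ∣U∣≡1+m = begin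
  ∑ (allVecs n (suc m)) (𝟙 ∘ arranges U)
    ≡⟨ ∑-allVecs-suc n m _ ⟩
  ∑ (allFin n) (λ i → ∑ (allVecs n m) (λ v → 𝟙 (lookup U i ∧ arranges (toggle i U) v)))
    ≡⟨ ∑-cong (allFin n) (λ i → startingWith i (lookup U i) refl) ⟩
  ∑ (allFin n) (λ i → 𝟙 (lookup U i) * + (m !))
    ≡⟨ ∑-𝟙-lookup U (+ (m !)) ⟩
  + ∣ U ∣ * + (m !)
    ≡⟨ cong (λ k → + k * + (m !)) ∣U∣≡1+m ⟩
  + suc m * + (m !)
    ≡⟨ ℤP.pos-* (suc m) (m !) ⟨
  + (suc m !) ∎
  where
  startingWith : ∀ i b → lookup U i ≡ b →
    ∑ (allVecs n m) (λ v → 𝟙 (b ∧ arranges (toggle i U) v)) ≡ 𝟙 b * + (m !)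
  startingWith i true U∋i =
    trans (arrangements m (toggle i U) (∣toggle∣≡ {X = U} U∋i ∣U∣≡1+m)) (sym (ℤP.*-identityˡ _))
  startingWith i false _ = ∑-zero (allVecs n m) (λ _ → refl)

-- |B|! (m − |B|)! = [B = ∅] m! + |B| (|B| − 1)! (m − |B|)!. For B = ∅ the truncated ∣ B ∣ ∸ 1 is
-- junk, but it is multiplied by ∣ B ∣ = 0.
weight-suc : ∀ m (B : Subset n) →
  𝟙 (⊥ =ₛ B) * + (m !) + + ∣ B ∣ * + ((∣ B ∣ ∸ 1) ! ℕ.* (m ∸ 1 ∸ (∣ B ∣ ∸ 1)) !) ≡ weight (suc m) B
weight-suc {n} m B with ∣ B ∣ in ∣B∣≡s
... | zero rewrite trans (cong (⊥ =ₛ_) (∣∣≡0⇒≡⊥ B ∣B∣≡s)) (=ₛ-refl ⊥) = begin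
  + 1 * + (m !) + + 0             ≡⟨ ℤP.+-identityʳ _ ⟩
  + 1 * + (m !)                   ≡⟨ ℤP.*-identityˡ _ ⟩
  + (m !)                         ≡⟨ cong +_ (ℕP.+-identityʳ (m !)) ⟨
  + (1 ℕ.* m !)                   ∎
... | suc b rewrite =ₛ-≢ {X = ⊥} {B} (λ ⊥≡B → ℕP.0≢1+n (trans (sym (∣⊥∣≡0 n)) (trans (cong ∣_∣ ⊥≡B) ∣B∣≡s))) = begin
  + 0 + + suc b * + (b ! ℕ.* (m ∸ 1 ∸ b) !)  ≡⟨ ℤP.+-identityˡ _ ⟩
  + suc b * + (b ! ℕ.* (m ∸ 1 ∸ b) !)        ≡⟨ ℤP.pos-* (suc b) _ ⟨
  + (suc b ℕ.* (b ! ℕ.* (m ∸ 1 ∸ b) !))      ≡⟨ cong +_ (ℕP.*-assoc (suc b) (b !) _) ⟨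
  + (suc b ! ℕ.* (m ∸ 1 ∸ b) !)              ≡⟨ cong (λ k → + (suc b ! ℕ.* k !)) (ℕP.∸-+-assoc m 1 b) ⟩
  + (suc b ! ℕ.* (m ∸ suc b) !)              ∎

module _ {n : ℕ} (a : Fin n) where

  -- For a vector with distinct entries, the set of entries preceding the first a.
  toggledBefore : Vec (Fin n) m → Subset n
  toggledBefore [] = ⊥
  toggledBefore (i ∷ v) = if i == a then ⊥ else toggle i (toggledBefore v)

  toggledBefore-≡ : (v : Vec (Fin n) m) → toggledBefore (a ∷ v) ≡ ⊥
  toggledBefore-≡ v rewrite ==-refl a = refl

  toggledBefore-≢ : {i : Fin n} (v : Vec (Fin n) m) → i ≢ a → toggledBefore (i ∷ v) ≡ toggle i (toggledBefore v)
  toggledBefore-≢ v i≢a rewrite ==-≢ i≢a = refl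

  a∉toggledBefore : (v : Vec (Fin n) m) → lookup (toggledBefore v) a ≡ false
  a∉toggledBefore [] = lookup-⊥ a
  a∉toggledBefore (i ∷ v) with i Fin.≟ a
  ... | yes refl = lookup-⊥ a
  ... | no i≢a = trans (lookup-toggle-≢ (toggledBefore v) (i≢a ∘ sym)) (a∉toggledBefore v)

  toggledBefore-⊆ : {U : Subset n} (v : Vec (Fin n) m) → arranges U v ≡ true →
    ∀ {j} → lookup (toggledBefore v) j ≡ true → lookup U j ≡ true
  toggledBefore-⊆ [] _ {j} ∋j = contradiction (trans (sym ∋j) (lookup-⊥ j)) λ ()
  toggledBefore-⊆ {U = U} (i ∷ v) arr {j} ∋j with i Fin.≟ a | j Fin.≟ i
  ... | yes _ | _ = contradiction (trans (sym ∋j) (lookup-⊥ j)) λ ()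
  ... | no _ | yes refl = BoolP.∧-conicalˡ _ _ arr
  ... | no _ | no j≢i = toggle-⊆ {X = U} (BoolP.∧-conicalˡ _ _ arr)
    (toggledBefore-⊆ v (BoolP.∧-conicalʳ _ _ arr) (trans (sym (lookup-toggle-≢ (toggledBefore v) j≢i)) ∋j))

  prefixCount : ∀ m → Subset n → Subset n → ℤ
  prefixCount m U B = ∑ (allVecs n m) (λ v → 𝟙 (arranges U v ∧ (toggledBefore v =ₛ B)))

  prefixCount-impossible : ∀ m (U B : Subset n) →
    (∀ v → arranges U v ≡ true → toggledBefore v ≢ B) → prefixCount m U B ≡ + 0
  prefixCount-impossible m U B impossible = ∑-zero (allVecs n m) term
    where
    term : ∀ v → 𝟙 (arranges U v ∧ (toggledBefore v =ₛ B)) ≡ + 0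
    term v with arranges U v in arr | toggledBefore v =ₛ B in before
    ... | true | true = contradiction (=ₛ⇒≡ before) (impossible v arr)
    ... | true | false = refl
    ... | false | _ = refl

  startingWith-≡ : ∀ m (U B : Subset n) → lookup U a ≡ true → ∣ U ∣ ≡ suc m →
    ∑ (allVecs n m) (λ v → 𝟙 (arranges U (a ∷ v) ∧ (toggledBefore (a ∷ v) =ₛ B))) ≡ 𝟙 (⊥ =ₛ B) * + (m !)
  startingWith-≡ m U B U∋a ∣U∣≡1+m = begin
    ∑ (allVecs n m) (λ v → 𝟙 (arranges U (a ∷ v) ∧ (toggledBefore (a ∷ v) =ₛ B)))
      ≡⟨ ∑-cong (allVecs n m) term ⟩
    ∑ (allVecs n m) (λ v → 𝟙 (arranges (toggle a U) v) * 𝟙 (⊥ =ₛ B))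
      ≡⟨ ∑-*ʳ (allVecs n m) _ _ ⟩
    ∑ (allVecs n m) (𝟙 ∘ arranges (toggle a U)) * 𝟙 (⊥ =ₛ B)
      ≡⟨ cong (_* 𝟙 (⊥ =ₛ B)) (arrangements m (toggle a U) (∣toggle∣≡ {X = U} U∋a ∣U∣≡1+m)) ⟩
    + (m !) * 𝟙 (⊥ =ₛ B)
      ≡⟨ ℤP.*-comm (+ (m !)) (𝟙 (⊥ =ₛ B)) ⟩
    𝟙 (⊥ =ₛ B) * + (m !) ∎
    where
    term : (v : Vec (Fin n) m) → 𝟙 ((lookup U a ∧ arranges (toggle a U) v) ∧ (toggledBefore (a ∷ v) =ₛ B))
               ≡ 𝟙 (arranges (toggle a U) v) * 𝟙 (⊥ =ₛ B)
    term v rewrite U∋a | toggledBefore-≡ v = 𝟙-∧ (arranges (toggle a U) v) (⊥ =ₛ B)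

  startingWith-≢ : ∀ m {i} (U B : Subset n) → lookup U i ≡ true → i ≢ a →
    ∑ (allVecs n m) (λ v → 𝟙 (arranges U (i ∷ v) ∧ (toggledBefore (i ∷ v) =ₛ B)))
      ≡ prefixCount m (toggle i U) (toggle i B)
  startingWith-≢ m {i} U B U∋i i≢a = ∑-cong (allVecs n m) term
    where
    term : (v : Vec (Fin n) m) → 𝟙 ((lookup U i ∧ arranges (toggle i U) v) ∧ (toggledBefore (i ∷ v) =ₛ B))
               ≡ 𝟙 (arranges (toggle i U) v ∧ (toggledBefore v =ₛ toggle i B))
    term v rewrite U∋i | toggledBefore-≢ v i≢a = cong (λ b → 𝟙 (_ ∧ b)) (=ₛ-⊕ (toggledBefore v) ⁅ i ⁆ B)

  startingWith-∉U : ∀ m {i} (U B : Subset n) → lookup U i ≡ false →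
    ∑ (allVecs n m) (λ v → 𝟙 (arranges U (i ∷ v) ∧ (toggledBefore (i ∷ v) =ₛ B))) ≡ + 0
  startingWith-∉U m {i} U B U∌i =
    ∑-zero (allVecs n m) (λ v → cong (λ b → 𝟙 ((b ∧ arranges (toggle i U) v) ∧ (toggledBefore (i ∷ v) =ₛ B))) U∌i)

  startingWith-∉B : ∀ m {i} (U B : Subset n) → lookup U i ≡ true → lookup B i ≡ false → i ≢ a →
    ∑ (allVecs n m) (λ v → 𝟙 (arranges U (i ∷ v) ∧ (toggledBefore (i ∷ v) =ₛ B))) ≡ + 0
  startingWith-∉B m {i} U B U∋i B∌i i≢a = trans (startingWith-≢ m U B U∋i i≢a)
    (prefixCount-impossible m (toggle i U) (toggle i B) λ v arr before →
      contradiction (trans (sym (toggledBefore-⊆ v arr (subst (λ X → lookup X i ≡ true) (sym before) B′∋i))) U′∌i)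
                    λ ())
    where
    U′∌i : lookup (toggle i U) i ≡ false
    U′∌i = trans (lookup-toggle-≡ i U) (cong not U∋i)
    B′∋i : lookup (toggle i B) i ≡ true
    B′∋i = trans (lookup-toggle-≡ i B) (cong not B∌i)

  -- Split on the first entry i: i = a leaves the empty prefix, any other i must lie in B, and
  -- then the rest arranges U ∖ {i} with prefix B ∖ {i}.
  prefixCount-formula : ∀ m (U B : Subset n) → lookup U a ≡ true → ∣ U ∣ ≡ m →
    (∀ {j} → lookup B j ≡ true → lookup U j ≡ true) → lookup B a ≡ false →
    prefixCount m U B ≡ weight m B
  prefixCount-formula zero U B U∋a ∣U∣≡0 _ _ =
    contradiction (trans (sym ∣U∣≡0) (∣∣≡suc∣toggle∣ U U∋a)) ℕP.0≢1+n
  prefixCount-formula (suc m) U B U∋a ∣U∣≡1+m B⊆U B∌a = begin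
    prefixCount (suc m) U B
      ≡⟨ ∑-allVecs-suc n m _ ⟩
    ∑ (allFin n) (λ i → ∑ (allVecs n m) (λ v → 𝟙 (arranges U (i ∷ v) ∧ (toggledBefore (i ∷ v) =ₛ B))))
      ≡⟨ ∑-cong (allFin n) startingWith ⟩
    ∑ (allFin n) (λ i → 𝟙 (i == a) * empty + 𝟙 (lookup B i) * K)
      ≡⟨ ∑-distrib-+ (allFin n) _ _ ⟩
    ∑ (allFin n) (λ i → 𝟙 (i == a) * empty) + ∑ (allFin n) (λ i → 𝟙 (lookup B i) * K)
      ≡⟨ cong₂ _+_ (∑-𝟙-== a empty) (∑-𝟙-lookup B K) ⟩
    empty + + ∣ B ∣ * K
      ≡⟨ weight-suc m B ⟩
    weight (suc m) B ∎
    where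
    empty K : ℤ
    empty = 𝟙 (⊥ =ₛ B) * + (m !)
    K = + ((∣ B ∣ ∸ 1) ! ℕ.* (m ∸ 1 ∸ (∣ B ∣ ∸ 1)) !)
    firstIsA : empty ≡ 𝟙 (a == a) * empty + 𝟙 false * K
    firstIsA rewrite ==-refl a = sym (trans (ℤP.+-identityʳ _) (ℤP.*-identityˡ _))
    firstIsNotA : ∀ {i} → i ≢ a → ∀ x → x ≡ 𝟙 (i == a) * empty + x
    firstIsNotA i≢a x rewrite ==-≢ i≢a = sym (ℤP.+-identityˡ x)
    startingWith : ∀ i → ∑ (allVecs n m) (λ v → 𝟙 (arranges U (i ∷ v) ∧ (toggledBefore (i ∷ v) =ₛ B)))
                       ≡ 𝟙 (i == a) * empty + 𝟙 (lookup B i) * K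
    startingWith i with a Fin.≟ i | lookup B i in B∋i
    ... | yes refl | true = contradiction (trans (sym B∋i) B∌a) λ ()
    ... | yes refl | false = trans (startingWith-≡ m U B U∋a ∣U∣≡1+m) firstIsA
    ... | no a≢i | true = begin
      ∑ (allVecs n m) (λ v → 𝟙 (arranges U (i ∷ v) ∧ (toggledBefore (i ∷ v) =ₛ B)))
        ≡⟨ startingWith-≢ m U B (B⊆U B∋i) (a≢i ∘ sym) ⟩
      prefixCount m (toggle i U) (toggle i B)
        ≡⟨ prefixCount-formula m (toggle i U) (toggle i B)
             (trans (lookup-toggle-≢ U a≢i) U∋a) (∣toggle∣≡ {X = U} (B⊆U B∋i) ∣U∣≡1+m)
             (toggle-⊆-toggle {X = B} {U} B∋i B⊆U) (trans (lookup-toggle-≢ B a≢i) B∌a) ⟩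
      weight m (toggle i B)
        ≡⟨ cong (λ s → + (s ! ℕ.* (m ∸ 1 ∸ s) !)) (cong (_∸ 1) (sym (∣∣≡suc∣toggle∣ B B∋i))) ⟩
      K
        ≡⟨ ℤP.*-identityˡ K ⟨
      + 1 * K
        ≡⟨ firstIsNotA (a≢i ∘ sym) _ ⟩
      𝟙 (i == a) * empty + + 1 * K ∎
    ... | no a≢i | false with lookup U i BoolP.≟ true
    ...   | no U∌i = trans (startingWith-∉U m U B (BoolP.¬-not U∌i)) (firstIsNotA (a≢i ∘ sym) _)
    ...   | yes U∋i = trans (startingWith-∉B m U B U∋i B∋i (a≢i ∘ sym)) (firstIsNotA (a≢i ∘ sym) _)

  prefixCount-⊤ : (B : Subset n) → prefixCount n ⊤ B ≡ 𝟙 (not (lookup B a)) * weight n B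
  prefixCount-⊤ B with lookup B a in B∋a
  ... | true = prefixCount-impossible n ⊤ B λ v _ before →
    contradiction (trans (sym (a∉toggledBefore v)) (trans (cong (λ X → lookup X a) before) B∋a)) λ ()
  ... | false = trans (prefixCount-formula n ⊤ B (lookup-⊤ a) (∣⊤∣≡n n) (λ {j} _ → lookup-⊤ j) B∋a)
                      (sym (ℤP.*-identityˡ _))

𝟙-difference : ∀ p q → 𝟙 p - 𝟙 q ≡ 𝟙 (p ∧ not q) - 𝟙 (not p ∧ q)
𝟙-difference true true = refl
𝟙-difference true false = refl
𝟙-difference false true = refl
𝟙-difference false false = refl

ρ-difference : (𝓕 : Family n) (a : Fin n) (C : Subset n) →
  𝟙 (not (lookup C a)) * (𝟙 (𝓕 C) - 𝟙 (𝓕 (toggle a C))) ≡ 𝟙 (ρ∅ 𝓕 a C) - 𝟙 (ρa 𝓕 a C)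
ρ-difference 𝓕 a C with lookup C a in C∋a
... | true = refl
... | false = trans (ℤP.*-identityˡ _) (trans (𝟙-difference (𝓕 C) (𝓕 (toggle a C)))
  (cong (λ D → 𝟙 (𝓕 C ∧ not (𝓕 D)) - 𝟙 (not (𝓕 C) ∧ 𝓕 D)) (sym (∪-⁅⁆ C∋a))))

-- Paths through the edge (A, A ∪ {a})

module _ {n : ℕ} (A : Subset n) (a : Fin n) where

  crossing : Subset n → ℤ
  crossing Y = 𝟙 (Y =ₛ A) - 𝟙 (Y =ₛ toggle a A)

  stepValue-toggle : (Y : Subset n) (i : Fin n) →
    stepValue A (toggle a A) (Y , toggle i Y) ≡ 𝟙 (i == a) * crossing Y
  stepValue-toggle Y i = begin
    𝟙 ((Y =ₛ A) ∧ (toggle i Y =ₛ toggle a A)) - 𝟙 ((toggle i Y =ₛ A) ∧ (Y =ₛ toggle a A))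
      ≡⟨ cong₂ (λ p q → 𝟙 p - 𝟙 q) forward (trans (BoolP.∧-comm (toggle i Y =ₛ A) (Y =ₛ toggle a A)) backward) ⟩
    𝟙 ((Y =ₛ A) ∧ (i == a)) - 𝟙 ((Y =ₛ toggle a A) ∧ (i == a))
      ≡⟨ cong₂ _-_ (𝟙-∧ (Y =ₛ A) (i == a)) (𝟙-∧ (Y =ₛ toggle a A) (i == a)) ⟩
    𝟙 (Y =ₛ A) * 𝟙 (i == a) - 𝟙 (Y =ₛ toggle a A) * 𝟙 (i == a)
      ≡⟨ factor (𝟙 (Y =ₛ A)) (𝟙 (Y =ₛ toggle a A)) (𝟙 (i == a)) ⟩
    𝟙 (i == a) * crossing Y ∎
    where
    factor : ∀ x y z → x * z - y * z ≡ z * (x - y)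
    factor = solve-∀
    forward : (Y =ₛ A) ∧ (toggle i Y =ₛ toggle a A) ≡ (Y =ₛ A) ∧ (i == a)
    forward = trans (∧-=ₛ-subst (λ X → toggle i X =ₛ toggle a A) Y A)
                    (cong ((Y =ₛ A) ∧_) (toggle-=ₛ-toggle i a A))
    backward : (Y =ₛ toggle a A) ∧ (toggle i Y =ₛ A) ≡ (Y =ₛ toggle a A) ∧ (i == a)
    backward = trans (∧-=ₛ-subst (λ X → toggle i X =ₛ A) Y (toggle a A)) (cong ((Y =ₛ toggle a A) ∧_) (begin
      (toggle i (toggle a A) =ₛ A)  ≡⟨ =ₛ-⊕ (toggle a A) ⁅ i ⁆ A ⟩
      (toggle a A =ₛ toggle i A)    ≡⟨ =ₛ-sym (toggle a A) (toggle i A) ⟩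
      (toggle i A =ₛ toggle a A)    ≡⟨ toggle-=ₛ-toggle i a A ⟩
      (i == a)                      ∎))

  pathValue : Subset n → List (Fin n) → ℤ
  pathValue Y is = ∑ (steps Y is) (stepValue A (toggle a A))

  pathValue-∌ : {U : Subset n} (Y : Subset n) (v : Vec (Fin n) m) →
    arranges U v ≡ true → lookup U a ≡ false → pathValue Y (toList v) ≡ + 0
  pathValue-∌ Y [] _ _ = refl
  pathValue-∌ {U = U} Y (i ∷ v) arr U∌a = cong₂ _+_
    (trans (stepValue-toggle Y i) (cong (λ b → 𝟙 b * crossing Y) (==-≢ i≢a)))
    (pathValue-∌ (toggle i Y) v (BoolP.∧-conicalʳ _ _ arr) (trans (lookup-toggle-≢ U (i≢a ∘ sym)) U∌a))
    where
    i≢a : i ≢ a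
    i≢a i≡a = contradiction (trans (sym (BoolP.∧-conicalˡ _ _ arr)) (trans (cong (lookup U) i≡a) U∌a)) λ ()

  pathValue-∋ : {U : Subset n} (Y : Subset n) (v : Vec (Fin n) m) →
    arranges U v ≡ true → ∣ U ∣ ≡ m → lookup U a ≡ true → pathValue Y (toList v) ≡ crossing (Y ⊕ toggledBefore a v)
  pathValue-∋ {U = U} Y [] _ ∣U∣≡0 U∋a = contradiction (trans (sym ∣U∣≡0) (∣∣≡suc∣toggle∣ U U∋a)) ℕP.0≢1+n
  pathValue-∋ {U = U} Y (i ∷ v) arr ∣U∣≡1+m U∋a with a Fin.≟ i
  ... | yes refl = begin
    stepValue A (toggle a A) (Y , toggle a Y) + pathValue (toggle a Y) (toList v)
      ≡⟨ cong₂ _+_ (stepValue-toggle Y a) (pathValue-∌ (toggle a Y) v (BoolP.∧-conicalʳ _ _ arr) U′∌a) ⟩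
    𝟙 (a == a) * crossing Y + + 0
      ≡⟨ cong (λ b → 𝟙 b * crossing Y + + 0) (==-refl a) ⟩
    + 1 * crossing Y + + 0
      ≡⟨ trans (ℤP.+-identityʳ _) (ℤP.*-identityˡ _) ⟩
    crossing Y
      ≡⟨ cong crossing (⊕-identityʳ Y) ⟨
    crossing (Y ⊕ ⊥)
      ≡⟨ cong (crossing ∘ (Y ⊕_)) (toggledBefore-≡ a v) ⟨
    crossing (Y ⊕ toggledBefore a (a ∷ v)) ∎
    where
    U′∌a : lookup (toggle a U) a ≡ false
    U′∌a = trans (lookup-toggle-≡ a U) (cong not U∋a)
  ... | no a≢i = begin
    stepValue A (toggle a A) (Y , toggle i Y) + pathValue (toggle i Y) (toList v)
      ≡⟨ cong₂ _+_ (trans (stepValue-toggle Y i) (cong (λ b → 𝟙 b * crossing Y) (==-≢ (a≢i ∘ sym))))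
                   (pathValue-∋ (toggle i Y) v (BoolP.∧-conicalʳ _ _ arr)
                      (∣toggle∣≡ {X = U} (BoolP.∧-conicalˡ _ _ arr) ∣U∣≡1+m) (trans (lookup-toggle-≢ U a≢i) U∋a)) ⟩
    + 0 + crossing (toggle i Y ⊕ toggledBefore a v)
      ≡⟨ ℤP.+-identityˡ _ ⟩
    crossing (toggle i Y ⊕ toggledBefore a v)
      ≡⟨ cong crossing (toggle-⊕ i Y (toggledBefore a v)) ⟩
    crossing (Y ⊕ toggle i (toggledBefore a v))
      ≡⟨ cong (crossing ∘ (Y ⊕_)) (toggledBefore-≢ a v (a≢i ∘ sym)) ⟨
    crossing (Y ⊕ toggledBefore a (i ∷ v)) ∎

  crossings : Family n → Subset n → ℤ
  crossings 𝓕 B = ∑ (filterᵇ 𝓕 (allSubsets n)) (λ X → crossing (X ⊕ B))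

  crossings-≡ : (𝓕 : Family n) (B : Subset n) → crossings 𝓕 B ≡ 𝟙 (𝓕 (A ⊕ B)) - 𝟙 (𝓕 (toggle a A ⊕ B))
  crossings-≡ 𝓕 B = begin
    crossings 𝓕 B
      ≡⟨ ∑-filterᵇ 𝓕 (allSubsets n) _ ⟩
    ∑ (allSubsets n) (λ X → 𝟙 (𝓕 X) * crossing (X ⊕ B))
      ≡⟨ ∑-cong (allSubsets n) term ⟩
    ∑ (allSubsets n) (λ X → 𝟙 (X =ₛ (A ⊕ B)) * 𝟙 (𝓕 X) - 𝟙 (X =ₛ (toggle a A ⊕ B)) * 𝟙 (𝓕 X))
      ≡⟨ ∑-distrib-- (allSubsets n) _ _ ⟩
    ∑ (allSubsets n) (λ X → 𝟙 (X =ₛ (A ⊕ B)) * 𝟙 (𝓕 X)) - ∑ (allSubsets n) (λ X → 𝟙 (X =ₛ (toggle a A ⊕ B)) * 𝟙 (𝓕 X))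
      ≡⟨ cong₂ _-_ (∑-select n (A ⊕ B) (𝟙 ∘ 𝓕)) (∑-select n (toggle a A ⊕ B) (𝟙 ∘ 𝓕)) ⟩
    𝟙 (𝓕 (A ⊕ B)) - 𝟙 (𝓕 (toggle a A ⊕ B)) ∎
    where
    distrib : ∀ x y z → z * (x - y) ≡ x * z - y * z
    distrib = solve-∀
    term : ∀ X → 𝟙 (𝓕 X) * crossing (X ⊕ B) ≡ 𝟙 (X =ₛ (A ⊕ B)) * 𝟙 (𝓕 X) - 𝟙 (X =ₛ (toggle a A ⊕ B)) * 𝟙 (𝓕 X)
    term X = trans (distrib (𝟙 ((X ⊕ B) =ₛ A)) (𝟙 ((X ⊕ B) =ₛ toggle a A)) (𝟙 (𝓕 X)))
      (cong₂ (λ p q → 𝟙 p * 𝟙 (𝓕 X) - 𝟙 q * 𝟙 (𝓕 X)) (=ₛ-⊕ X B A) (=ₛ-⊕ X B (toggle a A)))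

  Λ-toggle : (𝓕 : Family n) →
    Λ 𝓕 A (toggle a A) ≡ ∑ (allSubsets n) (λ B → 𝟙 (not (lookup B a)) * weight n B * crossings 𝓕 B)
  Λ-toggle 𝓕 = begin
    Λ 𝓕 A (toggle a A)
      ≡⟨ ∑-filterᵇ isInjective (allVecs n n) _ ⟩
    ∑ (allVecs n n) (λ σ → 𝟙 (isInjective σ) * ∑ (filterᵇ 𝓕 (allSubsets n)) (λ X → pathValue X (toList σ)))
      ≡⟨ ∑-cong (allVecs n n) permutationValue ⟩
    ∑ (allVecs n n) (λ σ → 𝟙 (arranges ⊤ σ) * crossings 𝓕 (toggledBefore a σ))
      ≡⟨ ∑-fibres (allVecs n n) (arranges ⊤) (toggledBefore a) (crossings 𝓕) ⟩
    ∑ (allSubsets n) (λ B → prefixCount a n ⊤ B * crossings 𝓕 B)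
      ≡⟨ ∑-cong (allSubsets n) (λ B → cong (_* crossings 𝓕 B) (prefixCount-⊤ a B)) ⟩
    ∑ (allSubsets n) (λ B → 𝟙 (not (lookup B a)) * weight n B * crossings 𝓕 B) ∎
    where
    permutationValue : ∀ σ →
      𝟙 (isInjective σ) * ∑ (filterᵇ 𝓕 (allSubsets n)) (λ X → pathValue X (toList σ))
        ≡ 𝟙 (arranges ⊤ σ) * crossings 𝓕 (toggledBefore a σ)
    permutationValue σ rewrite isInjective≡arranges⊤ σ = 𝟙-*-cong (arranges ⊤ σ) λ arr →
      ∑-cong (filterᵇ 𝓕 (allSubsets n)) (λ X → pathValue-∋ X σ arr (∣⊤∣≡n n) (lookup-⊤ a))

  summand-≡ : (𝓕 : Family n) → lookup A a ≡ false → (B : Subset n) →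
    𝟙 (not (lookup B a)) * weight n B * crossings 𝓕 B
      ≡ 𝟙 (ρ∅ 𝓕 a (B ⊕ A)) * weight n B - 𝟙 (ρa 𝓕 a (B ⊕ A)) * weight n B
  summand-≡ 𝓕 A∌a B = begin
    𝟙 (not (lookup B a)) * weight n B * crossings 𝓕 B
      ≡⟨ swap (𝟙 (not (lookup B a))) (weight n B) (crossings 𝓕 B) ⟩
    𝟙 (not (lookup B a)) * crossings 𝓕 B * weight n B
      ≡⟨ cong (λ c → 𝟙 (not (lookup B a)) * c * weight n B) (crossings-≡ 𝓕 B) ⟩
    𝟙 (not (lookup B a)) * (𝟙 (𝓕 (A ⊕ B)) - 𝟙 (𝓕 (toggle a A ⊕ B))) * weight n B
      ≡⟨ cong₂ (λ x d → 𝟙 (not x) * d * weight n B) B⊕A∋a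
               (cong₂ (λ C D → 𝟙 (𝓕 C) - 𝟙 (𝓕 D)) (⊕-comm A B) toggle-translate) ⟩
    𝟙 (not (lookup (B ⊕ A) a)) * (𝟙 (𝓕 (B ⊕ A)) - 𝟙 (𝓕 (toggle a (B ⊕ A)))) * weight n B
      ≡⟨ cong (_* weight n B) (ρ-difference 𝓕 a (B ⊕ A)) ⟩
    (𝟙 (ρ∅ 𝓕 a (B ⊕ A)) - 𝟙 (ρa 𝓕 a (B ⊕ A))) * weight n B
      ≡⟨ distrib (𝟙 (ρ∅ 𝓕 a (B ⊕ A))) (𝟙 (ρa 𝓕 a (B ⊕ A))) (weight n B) ⟩
    𝟙 (ρ∅ 𝓕 a (B ⊕ A)) * weight n B - 𝟙 (ρa 𝓕 a (B ⊕ A)) * weight n B ∎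
    where
    swap : ∀ x w c → x * w * c ≡ x * c * w
    swap = solve-∀
    distrib : ∀ p q w → (p - q) * w ≡ p * w - q * w
    distrib = solve-∀
    B⊕A∋a : lookup B a ≡ lookup (B ⊕ A) a
    B⊕A∋a = sym (trans (VecP.lookup-zipWith _xor_ a B A) (trans (cong (lookup B a xor_) A∌a) (BoolP.xor-identityʳ _)))
    toggle-translate : toggle a A ⊕ B ≡ toggle a (B ⊕ A)
    toggle-translate = trans (⊕-comm (toggle a A) B) (sym (⊕-assoc B A ⁅ a ⁆))

mainTheorem4 : (n : ℕ) (𝓕 : Family n) (a : Fin n) (A : Subset n) →
    lookup A a ≡ false →
    Λ 𝓕 A (A ∪ ⁅ a ⁆) ≡ weightedSum A (ρ∅ 𝓕 a) - weightedSum A (ρa 𝓕 a)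
mainTheorem4 n 𝓕 a A A∌a = begin
  Λ 𝓕 A (A ∪ ⁅ a ⁆)
    ≡⟨ cong (Λ 𝓕 A) (∪-⁅⁆ A∌a) ⟩
  Λ 𝓕 A (toggle a A)
    ≡⟨ Λ-toggle A a 𝓕 ⟩
  ∑ (allSubsets n) (λ B → 𝟙 (not (lookup B a)) * weight n B * crossings A a 𝓕 B)
    ≡⟨ ∑-cong (allSubsets n) (summand-≡ A a 𝓕 A∌a) ⟩
  ∑ (allSubsets n) (λ B → 𝟙 (ρ∅ 𝓕 a (B ⊕ A)) * weight n B - 𝟙 (ρa 𝓕 a (B ⊕ A)) * weight n B)
    ≡⟨ ∑-distrib-- (allSubsets n) _ _ ⟩
  ∑ (allSubsets n) (λ B → 𝟙 (ρ∅ 𝓕 a (B ⊕ A)) * weight n B) - ∑ (allSubsets n) (λ B → 𝟙 (ρa 𝓕 a (B ⊕ A)) * weight n B)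
    ≡⟨ cong₂ _-_ (weightedSum-∑ A (ρ∅ 𝓕 a)) (weightedSum-∑ A (ρa 𝓕 a)) ⟨
  weightedSum A (ρ∅ 𝓕 a) - weightedSum A (ρa 𝓕 a) ∎
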